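{- Let $G = (V,E)$ be a graph and $c \geq 0$. Suppose $V_1, V_2 \subset V$ satisfy: (1) $V_1 \cup V_2 = V$; (2) $|V_1 \cap V_2| \leq c$; (3) every vertex of $V_1$ has a neighbour in $V_2$ and every vertex of $V_2$ has a neighbour in $V_1$; (4) $G[V_1]$ and $G[V_2]$ are connected. Then $rvc(G) \leq diam(G[V_1]) + diam(G[V_2]) + c + 2$.
   Context: A vertex colouring of a graph $G$ is called rainbow if between any two vertices of $G$ there is a path all of whose internal vertices have distinct colours. The rainbow vertex connectivity $rvc(G)$ of a connected graph $G$ is the minimum number of colours in a rainbow vertex colouring of $G$. $G[U]$ denotes the subgraph induced by $U$, and $diam$ denotes diameter. -}

module Defs where

open import Level using (0ℓ)
open import Data.Nat using (ℕ; zero; suc; _≤_)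
open import Data.Fin using (Fin)
open import Data.Fin.Subset using (Subset; _∈_)
open import Data.List using (List; []; _∷_; _++_; length; map)
open import Data.List.Relation.Unary.All using (All)
open import Data.List.Relation.Unary.Unique.Propositional using (Unique)
open import Data.Product using (Σ; _×_; ∃; ∃-syntax)
open import Data.Sum using (_⊎_)
open import Relation.Binary.PropositionalEquality using (_≡_; _≢_)
open import Relation.Nullary using (¬_)

record Graph (n : ℕ) : Set₁ where
  field
    E      : Fin n → Fin n → Set
    sym    : ∀ {u v} → E u v → E v u
    irrefl : ∀ {u} → ¬ E u u

module _ {n : ℕ} (G : Graph n) where
  open Graph G

  -- u , w₁ , … , wₖ , v  with consecutive vertices adjacent (ws = internal vertices)
  AdjChain : Fin n → List (Fin n) → Fin n → Set
  AdjChain u []       v = E u v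
  AdjChain u (w ∷ ws) v = E u w × AdjChain w ws v

  Path : Fin n → List (Fin n) → Fin n → Set
  Path u ws v = AdjChain u ws v × Unique (u ∷ ws ++ v ∷ [])

  Rainbow : {k : ℕ} → (Fin n → Fin k) → Set
  Rainbow col = ∀ u v → u ≢ v →
    ∃[ ws ] (Path u ws v × Unique (map col ws))

  RvcAtMost : ℕ → Set
  RvcAtMost k = Σ (Fin n → Fin k) Rainbow

  PathIn : Subset n → Fin n → List (Fin n) → Fin n → Set
  PathIn U u ws v = Path u ws v × All (_∈ U) ws

  HasPathLen : Subset n → Fin n → Fin n → ℕ → Set
  HasPathLen U u v k =
    (u ≡ v × k ≡ 0) ⊎ (∃[ ws ] (PathIn U u ws v × suc (length ws) ≡ k))

  Dist : Subset n → Fin n → Fin n → ℕ → Set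
  Dist U u v k = HasPathLen U u v k × (∀ j → HasPathLen U u v j → k ≤ j)

  Connected : Subset n → Set
  Connected U = (∃[ u ] u ∈ U) ×
    (∀ u v → u ∈ U → v ∈ U → ∃[ k ] HasPathLen U u v k)

  IsDiam : Subset n → ℕ → Set
  IsDiam U d =
    (∀ u v → u ∈ U → v ∈ U → ∃[ k ] (Dist U u v k × k ≤ d)) ×
    (∃[ u ] ∃[ v ] (u ∈ U × v ∈ U × Dist U u v d))

-- Fix an edge x – y with x ∈ V₁ and y ∈ V₂. Colour a vertex of V₁ ∖ V₂ by its distance to x in
-- G[V₁] (d₁ + 1 colours), a vertex of V₂ ∖ V₁ by its distance to y in G[V₂] (d₂ + 1 further
-- colours), and give each of the at most c vertices of V₁ ∩ V₂ a colour of its own. To join u and v,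
-- walk from u (after one step into V₁ if u ∉ V₁) along strictly decreasing distance to x, cross to
-- y, and climb to v in the same way inside V₂. Distances are distinct along each descent, so the
-- inner vertices of this walk lying in V₁ ∖ V₂, and those lying in V₂ ∖ V₁, carry distinct colours;
-- erasing loops turns the walk into a path whose inner vertices are among those of the walk.

module Submission where

open import Defs
open import Data.Bool using (true; false)
open import Data.Nat using (ℕ; suc; _+_; _≤_; _<_; s≤s; z≤n)
open import Data.Nat.Properties using (<-trans; <⇒≢; n≤0⇒n≡0)
open import Data.Nat.Induction using (<-wellFounded)
open import Data.Nat.Tactic.RingSolver using (solve-∀)
open import Data.Fin using (Fin; zero; suc; toℕ; fromℕ<; inject≤; cast; join; splitAt)
open import Data.Fin.Properties
  using (_≟_; suc-injective; toℕ-injective; toℕ-cast; splitAt-join; fromℕ<-injective; inject≤-injective)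
open import Data.Fin.Subset using (Subset; _∈_; _∉_; _∪_; _∩_; ⊤; ∣_∣)
open import Data.Fin.Subset.Properties using (_∈?_; x∈p∩q⁺; x∈p∪q⁻; ∈⊤; ∪-comm)
open import Data.Vec.Base using (_∷_; _[_]=_)
open import Data.List using (List; []; _∷_; _++_; map)
open import Data.List.Relation.Unary.All as All using (All; []; _∷_)
open import Data.List.Relation.Unary.All.Properties as All using (¬Any⇒All¬)
open import Data.List.Relation.Unary.Any using (here; there)
open import Data.List.Relation.Unary.AllPairs as AllPairs using (AllPairs; []; _∷_)
open import Data.List.Relation.Unary.Linked as Linked using (Linked; [-]; _∷_)
open import Data.List.Relation.Unary.Linked.Properties using (Linked⇒AllPairs)
open import Data.List.Relation.Unary.Unique.Propositional using (Unique)
open import Data.List.Membership.Propositional using () renaming (_∈_ to _∈ₗ_; _∉_ to _∉ₗ_)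
open import Data.List.Membership.Propositional.Properties using (∈-++⁻)
open import Data.List.Relation.Binary.Subset.Propositional using (_⊆_)
open import Data.List.Relation.Binary.Subset.Propositional.Properties using (⊆-refl; ∷⁺ʳ)
open import Data.Product using (Σ-syntax; ∃-syntax; _×_; _,_; proj₁; proj₂)
open import Data.Sum as Sum using (_⊎_; inj₁; inj₂)
open import Data.Sum.Properties using (inj₁-injective; inj₂-injective)
open import Function using (_∘_; flip)
open import Induction.WellFounded using (Acc; acc)
open import Relation.Binary.Construct.Closure.ReflexiveTransitive
  using (Star; ε; _◅_; _◅◅_; revApp; reverse)
open import Relation.Binary.PropositionalEquality
  using (_≡_; _≢_; refl; sym; trans; cong; subst; subst₂; ≢-sym; module ≡-Reasoning)
open import Relation.Nullary using (Dec; yes; no; contradiction)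

open _[_]=_

InjectiveOn : {A B : Set} → (A → B) → (A → Set) → Set
InjectiveOn f P = ∀ {a b} → P a → P b → f a ≡ f b → a ≡ b

module _ {A B : Set} {f : A → B} where

  Unique-map⁺-injectiveOn : ∀ {P : A → Set} {xs} →
    InjectiveOn f P → All P xs → Unique xs → Unique (map f xs)
  Unique-map⁺-injectiveOn inj [] [] = []
  Unique-map⁺-injectiveOn inj (px ∷ pxs) (x∉xs ∷ xs!) =
    All.map⁺ (All.zipWith (λ (x≢y , py) → x≢y ∘ inj px py) (x∉xs , pxs))
      ∷ Unique-map⁺-injectiveOn inj pxs xs!

  AllPairs⇒injectiveOn : ∀ {xs} → AllPairs (λ a b → f a ≢ f b) xs → InjectiveOn f (_∈ₗ xs)
  AllPairs⇒injectiveOn (_ ∷ _)  (here refl) (here refl) _   = refl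
  AllPairs⇒injectiveOn (h ∷ _)  (here refl) (there b∈) fa≡fb = contradiction fa≡fb (All.lookup h b∈)
  AllPairs⇒injectiveOn (h ∷ _)  (there a∈) (here refl) fa≡fb = contradiction (sym fa≡fb) (All.lookup h a∈)
  AllPairs⇒injectiveOn (_ ∷ hs) (there a∈) (there b∈) fa≡fb = AllPairs⇒injectiveOn hs a∈ b∈ fa≡fb

decreasing⇒injectiveOn : ∀ {A : Set} {f : A → ℕ} {xs} →
  Linked (λ a b → f b < f a) xs → InjectiveOn f (_∈ₗ xs)
decreasing⇒injectiveOn =
  AllPairs⇒injectiveOn ∘ AllPairs.map (≢-sym ∘ <⇒≢) ∘ Linked⇒AllPairs (flip <-trans)

Unique-∷ʳ⁻ : ∀ {A : Set} {xs : List A} {y} → Unique (xs ++ y ∷ []) → Unique xs × y ∉ₗ xs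
Unique-∷ʳ⁻ {xs = []} _ = [] , λ ()
Unique-∷ʳ⁻ {xs = x ∷ xs} (x∉ ∷ xs!) with Unique-∷ʳ⁻ xs!
... | xs!′ , y∉xs = All.++⁻ˡ xs x∉ ∷ xs!′ , λ
  { (here refl) → All.head (All.++⁻ʳ xs x∉) refl
  ; (there y∈xs) → y∉xs y∈xs }

module _ {V : Set} {E : V → V → Set} where

  targets : ∀ {a b} → Star E a b → List V
  targets ε = []
  targets (_◅_ {j = j} _ p) = j ∷ targets p

  vertices : ∀ {a b} → Star E a b → List V
  vertices {a} p = a ∷ targets p

  targets-◅◅ : ∀ {a b c} (p : Star E a b) (q : Star E b c) →
    targets (p ◅◅ q) ≡ targets p ++ targets q
  targets-◅◅ ε q = refl
  targets-◅◅ (_ ◅ p) q = cong (_ ∷_) (targets-◅◅ p q)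

  module _ (E-sym : ∀ {a b} → E a b → E b a) where

    ∈-vertices-revApp : ∀ {i j k z} (p : Star E j i) (q : Star E j k) →
      z ∈ₗ vertices (revApp E-sym p q) → z ∈ₗ vertices p ⊎ z ∈ₗ vertices q
    ∈-vertices-revApp ε q z∈ = inj₂ z∈
    ∈-vertices-revApp (e ◅ p) q z∈ with ∈-vertices-revApp p (E-sym e ◅ q) z∈
    ... | inj₁ z∈p = inj₁ (there z∈p)
    ... | inj₂ (here refl) = inj₁ (there (here refl))
    ... | inj₂ (there z∈q) = inj₂ z∈q

    ∈-vertices-reverse : ∀ {a b z} (p : Star E a b) →
      z ∈ₗ vertices (reverse E-sym p) → z ∈ₗ vertices p
    ∈-vertices-reverse p z∈ with ∈-vertices-revApp p ε z∈
    ... | inj₁ z∈p = z∈p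
    ... | inj₂ (here refl) = here refl

module _ {n : ℕ} (G : Graph n) where
  open Graph G using (E; irrefl)
  open import Data.List.Membership.DecPropositional (_≟_ {n}) using () renaming (_∈?_ to _∈ₗ?_)

  Path-cons : ∀ {a w b ws} → E a w → a ≢ b → a ∉ₗ ws → Path G w ws b → Path G a (w ∷ ws) b
  Path-cons {ws = ws} e a≢b a∉ws (chain , w∷ws!) =
    (e , chain) , ((λ { refl → irrefl e }) ∷ All.++⁺ (¬Any⇒All¬ ws a∉ws) (a≢b ∷ [])) ∷ w∷ws!

  Path-suffix : ∀ {w ws b a} → Path G w ws b → a ∈ₗ ws → ∃[ s ] (Path G a s b × s ⊆ ws)
  Path-suffix {ws = _ ∷ xs} ((_ , chain) , _ ∷ xs!) (here refl) = xs , (chain , xs!) , there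
  Path-suffix ((_ , chain) , _ ∷ xs!) (there a∈xs) with Path-suffix (chain , xs!) a∈xs
  ... | s , path , s⊆xs = s , path , there ∘ s⊆xs

  Path-◅ : ∀ {a w b ws} → E a w → a ≢ b → Path G w ws b →
    ∃[ ws′ ] (Path G a ws′ b × ws′ ⊆ w ∷ ws)
  Path-◅ {a} {w} {ws = ws} e a≢b path with a ∈ₗ? ws
  ... | no a∉ws = w ∷ ws , Path-cons e a≢b a∉ws path , ⊆-refl
  ... | yes a∈ws with Path-suffix path a∈ws
  ...   | s , path′ , s⊆ws = s , path′ , there ∘ s⊆ws

  loop-erasure : ∀ {a b} (p : Star E a b) → a ≢ b → ∃[ ws ] (Path G a ws b × ws ⊆ targets p)
  loop-erasure ε a≢b = contradiction refl a≢b
  loop-erasure {b = b} (_◅_ {j = w} e p) a≢b with w ≟ b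
  ... | yes refl = [] , (e , (a≢b ∷ []) ∷ [] ∷ []) , λ ()
  ... | no w≢b with loop-erasure p w≢b
  ...   | ws , path , ws⊆p with Path-◅ e a≢b path
  ...     | ws′ , path′ , ws′⊆ = ws′ , path′ , ∷⁺ʳ w ws⊆p ∘ ws′⊆

  rainbow-path : ∀ {C : Set} {col : Fin n → C} {P : Fin n → Set} → InjectiveOn col P →
    ∀ {a b} (p : Star E a b) → a ≢ b → (∀ {z} → z ∈ₗ targets p → z ≢ b → P z) →
    ∃[ ws ] (Path G a ws b × Unique (map col ws))
  rainbow-path {P = P} col-inj p a≢b good with loop-erasure p a≢b
  ... | ws , path@(_ , _ ∷ ws∷b!) , ws⊆ with Unique-∷ʳ⁻ ws∷b!
  ...   | ws! , b∉ws = ws , path , Unique-map⁺-injectiveOn col-inj good-ws ws!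
    where
    good-ws : All P ws
    good-ws = All.tabulate λ z∈ws → good (ws⊆ z∈ws) λ { refl → b∉ws z∈ws }

Dominating : ∀ {n} → Graph n → Subset n → Set
Dominating G U = ∀ u → u ∈ U ⊎ ∃[ w ] (w ∈ U × Graph.E G u w)

cover⇒dominating : ∀ {n} (G : Graph n) {V₁ V₂ : Subset n} → V₁ ∪ V₂ ≡ ⊤ →
  (∀ u → u ∈ V₂ → ∃[ w ] (w ∈ V₁ × Graph.E G u w)) → Dominating G V₁
cover⇒dominating G {V₁} {V₂} cover V₂→V₁ u
  with x∈p∪q⁻ V₁ V₂ (subst (u ∈_) (sym cover) ∈⊤)
... | inj₁ u∈V₁ = inj₁ u∈V₁
... | inj₂ u∈V₂ = inj₂ (V₂→V₁ u u∈V₂)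

module DistanceTo {n : ℕ} (G : Graph n) (U : Subset n) {d : ℕ} (diam : IsDiam G U d)
                  {t : Fin n} (t∈U : t ∈ U) where

  dist : Fin n → ℕ
  dist w with w ∈? U
  ... | yes w∈U = proj₁ (proj₁ diam w t w∈U t∈U)
  ... | no _ = 0

  dist-Dist : ∀ {w} → w ∈ U → Dist G U w t (dist w)
  dist-Dist {w} w∈U with w ∈? U
  ... | yes w∈U′ = proj₁ (proj₂ (proj₁ diam w t w∈U′ t∈U))
  ... | no w∉U = contradiction w∈U w∉U

  dist≤diam : ∀ w → dist w ≤ d
  dist≤diam w with w ∈? U
  ... | yes w∈U = proj₂ (proj₂ (proj₁ diam w t w∈U t∈U))
  ... | no _ = z≤n

module Descent {n : ℕ} (G : Graph n) (U : Subset n) {t : Fin n} (t∈U : t ∈ U)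
               (dist : Fin n → ℕ) (dist-Dist : ∀ {w} → w ∈ U → Dist G U w t (dist w)) where
  open Graph G using (E)

  dist-target : dist t ≡ 0
  dist-target = n≤0⇒n≡0 (proj₂ (dist-Dist t∈U) 0 (inj₁ (refl , refl)))

  closer-neighbour : ∀ {w} → w ∈ U → w ≢ t → ∃[ w′ ] (w′ ∈ U × E w w′ × dist w′ < dist w)
  closer-neighbour {w} w∈U w≢t with dist-Dist w∈U
  ... | inj₁ (w≡t , _) , _ = contradiction w≡t w≢t
  ... | inj₂ ([] , ((e , _) , _) , len) , _ =
    t , t∈U , e , subst₂ _<_ (sym dist-target) len (s≤s z≤n)
  ... | inj₂ (w′ ∷ r , (((e , chain) , _ ∷ r!) , w′∈U ∷ r⊆U) , len) , _ =
    w′ , w′∈U , e , subst (dist w′ <_) len (s≤s (proj₂ (dist-Dist w′∈U) _ tail-path))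
    where
    tail-path : HasPathLen G U w′ t _
    tail-path = inj₂ (r , ((chain , r!) , r⊆U) , refl)

  DescendingWalk : Fin n → Set
  DescendingWalk w = Σ[ p ∈ Star E w t ]
    (All (_∈ U) (vertices p) × Linked (λ a b → dist b < dist a) (vertices p))

  descending-walk : ∀ {w} → w ∈ U → Acc _<_ (dist w) → DescendingWalk w
  descending-walk {w} w∈U (acc rec) with w ≟ t
  ... | yes refl = ε , w∈U ∷ [] , [-]
  ... | no w≢t with closer-neighbour w∈U w≢t
  ...   | w′ , w′∈U , e , closer with descending-walk w′∈U (rec closer)
  ...     | p , p⊆U , p↓ = e ◅ p , w∈U ∷ p⊆U , closer ∷ p↓

  Approach : Fin n → Set
  Approach u = Σ[ p ∈ Star E u t ] (All (_∈ U) (targets p) × InjectiveOn dist (_∈ₗ targets p))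

  approach : Dominating G U → ∀ u → Approach u
  approach dom u with dom u
  ... | inj₁ u∈U with descending-walk u∈U (<-wellFounded _)
  ...   | p , _ ∷ p⊆U , p↓ = p , p⊆U , decreasing⇒injectiveOn (Linked.tail p↓)
  approach dom u | inj₂ (w , w∈U , e) with descending-walk w∈U (<-wellFounded _)
  ...   | p , p⊆U , p↓ = e ◅ p , p⊆U , decreasing⇒injectiveOn p↓

rank : ∀ {m} (p : Subset m) {i} → i ∈ p → Fin ∣ p ∣
rank (true ∷ p) here = zero
rank (true ∷ p) (there i∈p) = suc (rank p i∈p)
rank (false ∷ p) (there i∈p) = rank p i∈p

rank-injective : ∀ {m} (p : Subset m) {i j} (i∈p : i ∈ p) (j∈p : j ∈ p) →
  rank p i∈p ≡ rank p j∈p → i ≡ j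
rank-injective (true ∷ p) here here _ = refl
rank-injective (true ∷ p) (there i∈p) (there j∈p) eq =
  cong suc (rank-injective p i∈p j∈p (suc-injective eq))
rank-injective (false ∷ p) (there i∈p) (there j∈p) eq = cong suc (rank-injective p i∈p j∈p eq)

join-injective : ∀ m n {i j : Fin m ⊎ Fin n} → join m n i ≡ join m n j → i ≡ j
join-injective m n {i} {j} eq = begin
  i                      ≡⟨ splitAt-join m n i ⟨
  splitAt m (join m n i) ≡⟨ cong (splitAt m) eq ⟩
  splitAt m (join m n j) ≡⟨ splitAt-join m n j ⟩
  j                      ∎
  where open ≡-Reasoning

cast-injective : ∀ {m n} .(eq : m ≡ n) {i j : Fin m} → cast eq i ≡ cast eq j → i ≡ j
cast-injective eq {i} {j} e = toℕ-injective (begin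
  toℕ i          ≡⟨ toℕ-cast eq i ⟨
  toℕ (cast eq i) ≡⟨ cong toℕ e ⟩
  toℕ (cast eq j) ≡⟨ toℕ-cast eq j ⟩
  toℕ j          ∎)
  where open ≡-Reasoning

LevelSeparating : ∀ {n} {C : Set} (V₁ V₂ : Subset n) (dist₁ dist₂ : Fin n → ℕ) → (Fin n → C) → Set₁
LevelSeparating {n} V₁ V₂ dist₁ dist₂ col = ∀ {P₁ P₂ : Fin n → Set} →
  (∀ {z} → P₁ z → z ∈ V₁) → InjectiveOn dist₁ P₁ →
  (∀ {z} → P₂ z → z ∈ V₂) → InjectiveOn dist₂ P₂ →
  InjectiveOn col (λ z → P₁ z ⊎ P₂ z)

module Palette {n : ℕ} (V₁ V₂ : Subset n) {c : ℕ} (c-bound : ∣ V₁ ∩ V₂ ∣ ≤ c)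
               {d₁ d₂ : ℕ} (dist₁ dist₂ : Fin n → ℕ)
               (dist₁≤ : ∀ w → dist₁ w ≤ d₁) (dist₂≤ : ∀ w → dist₂ w ≤ d₂) where

  Palette : Set
  Palette = Fin (suc d₁) ⊎ Fin (suc d₂) ⊎ Fin c

  paletteAt : ∀ w → Dec (w ∈ V₁) → Dec (w ∈ V₂) → Palette
  paletteAt w (yes w∈V₁) (yes w∈V₂) =
    inj₂ (inj₂ (inject≤ (rank (V₁ ∩ V₂) (x∈p∩q⁺ (w∈V₁ , w∈V₂))) c-bound))
  paletteAt w (yes _)    (no _)     = inj₁ (fromℕ< (s≤s (dist₁≤ w)))
  paletteAt w (no _)     _          = inj₂ (inj₁ (fromℕ< (s≤s (dist₂≤ w))))

  palette : Fin n → Palette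
  palette w = paletteAt w (w ∈? V₁) (w ∈? V₂)

  encode : Palette → Fin (d₁ + d₂ + c + 2)
  encode = cast (size d₁ d₂ c) ∘ join (suc d₁) (suc d₂ + c) ∘ Sum.map₂ (join (suc d₂) c)
    where
    size : ∀ d₁ d₂ c → suc d₁ + (suc d₂ + c) ≡ d₁ + d₂ + c + 2
    size = solve-∀

  encode-injective : ∀ {i j} → encode i ≡ encode j → i ≡ j
  encode-injective eq = inner-injective (join-injective (suc d₁) (suc d₂ + c) (cast-injective _ eq))
    where
    inner-injective : ∀ {i j : Palette} →
      Sum.map₂ (join (suc d₂) c) i ≡ Sum.map₂ (join (suc d₂) c) j → i ≡ j
    inner-injective {inj₁ _} {inj₁ _} refl = refl
    inner-injective {inj₁ _} {inj₂ _} ()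
    inner-injective {inj₂ _} {inj₁ _} ()
    inner-injective {inj₂ _} {inj₂ _} eq = cong inj₂ (join-injective (suc d₂) c (inj₂-injective eq))

  colouring : Fin n → Fin (d₁ + d₂ + c + 2)
  colouring = encode ∘ palette

  colouring-separates : LevelSeparating V₁ V₂ dist₁ dist₂ colouring
  colouring-separates {P₁} {P₂} P₁⊆V₁ dist₁-inj P₂⊆V₂ dist₂-inj {a} {b} a∈ b∈ eq =
    separate (a ∈? V₁) (a ∈? V₂) (b ∈? V₁) (b ∈? V₂) (encode-injective eq)
    where
    only₁ : ∀ {z} → P₁ z ⊎ P₂ z → z ∉ V₂ → P₁ z
    only₁ (inj₁ z∈P₁) _ = z∈P₁
    only₁ (inj₂ z∈P₂) z∉V₂ = contradiction (P₂⊆V₂ z∈P₂) z∉V₂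

    only₂ : ∀ {z} → P₁ z ⊎ P₂ z → z ∉ V₁ → P₂ z
    only₂ (inj₁ z∈P₁) z∉V₁ = contradiction (P₁⊆V₁ z∈P₁) z∉V₁
    only₂ (inj₂ z∈P₂) _ = z∈P₂

    separate : (a₁ : Dec (a ∈ V₁)) (a₂ : Dec (a ∈ V₂)) (b₁ : Dec (b ∈ V₁)) (b₂ : Dec (b ∈ V₂)) →
      paletteAt a a₁ a₂ ≡ paletteAt b b₁ b₂ → a ≡ b
    separate (yes _) (yes _) (yes _) (yes _) eq =
      rank-injective (V₁ ∩ V₂) _ _ (inject≤-injective _ _ _ _ (inj₂-injective (inj₂-injective eq)))
    separate (yes _) (no a∉V₂) (yes _) (no b∉V₂) eq =
      dist₁-inj (only₁ a∈ a∉V₂) (only₁ b∈ b∉V₂) (fromℕ<-injective _ _ _ _ (inj₁-injective eq))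
    separate (no a∉V₁) _ (no b∉V₁) _ eq =
      dist₂-inj (only₂ a∈ a∉V₁) (only₂ b∈ b∉V₁) (fromℕ<-injective _ _ _ _ (inj₁-injective (inj₂-injective eq)))
    separate (yes _) (yes _) (yes _) (no _) ()
    separate (yes _) (yes _) (no _)  _      ()
    separate (yes _) (no _)  (yes _) (yes _) ()
    separate (yes _) (no _)  (no _)  _      ()
    separate (no _)  _       (yes _) (yes _) ()
    separate (no _)  _       (yes _) (no _) ()

module Bridge {n : ℕ} (G : Graph n) {V₁ V₂ : Subset n} {x y : Fin n}
              (x∈V₁ : x ∈ V₁) (y∈V₂ : y ∈ V₂) (x-y : Graph.E G x y)
              (dist₁ dist₂ : Fin n → ℕ)
              (dist₁-Dist : ∀ {w} → w ∈ V₁ → Dist G V₁ w x (dist₁ w))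
              (dist₂-Dist : ∀ {w} → w ∈ V₂ → Dist G V₂ w y (dist₂ w))
              (V₁-dominating : Dominating G V₁) (V₂-dominating : Dominating G V₂) where
  open Graph G using (E) renaming (sym to E-sym)
  open Descent G V₁ x∈V₁ dist₁ dist₁-Dist using () renaming (approach to approach₁)
  open Descent G V₂ y∈V₂ dist₂ dist₂-Dist using () renaming (approach to approach₂)

  rainbow : ∀ {k} (col : Fin n → Fin k) → LevelSeparating V₁ V₂ dist₁ dist₂ col → Rainbow G col
  rainbow col separating u v u≢v with approach₁ V₁-dominating u | approach₂ V₂-dominating v
  ... | p₁ , p₁⊆V₁ , p₁-inj | p₂ , p₂⊆V₂ , p₂-inj =
    rainbow-path G (separating (All.lookup p₁⊆V₁) p₁-inj (All.lookup p₂⊆V₂) p₂-inj)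
      (p₁ ◅◅ x-y ◅ reverse E-sym p₂) u≢v on-approaches
    where
    on-approaches : ∀ {z} → z ∈ₗ targets (p₁ ◅◅ x-y ◅ reverse E-sym p₂) → z ≢ v →
      z ∈ₗ targets p₁ ⊎ z ∈ₗ targets p₂
    on-approaches z∈ z≢v with ∈-++⁻ (targets p₁) (subst (_ ∈ₗ_) (targets-◅◅ p₁ _) z∈)
    ... | inj₁ z∈p₁ = inj₁ z∈p₁
    ... | inj₂ z∈p₂′ with ∈-vertices-reverse E-sym p₂ z∈p₂′
    ...   | here z≡v = contradiction z≡v z≢v
    ...   | there z∈p₂ = inj₂ z∈p₂

lemma10 : (n : ℕ) (G : Graph n) (c : ℕ) (V₁ V₂ : Subset n) →
    V₁ ∪ V₂ ≡ ⊤ →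
    ∣ V₁ ∩ V₂ ∣ ≤ c →
    (∀ u → u ∈ V₁ → ∃[ w ] (w ∈ V₂ × Graph.E G u w)) →
    (∀ u → u ∈ V₂ → ∃[ w ] (w ∈ V₁ × Graph.E G u w)) →
    Connected G V₁ → Connected G V₂ →
    (d₁ d₂ : ℕ) → IsDiam G V₁ d₁ → IsDiam G V₂ d₂ →
    RvcAtMost G (d₁ + d₂ + c + 2)
lemma10 n G c V₁ V₂ cover c-bound V₁→V₂ V₂→V₁ ((x , x∈V₁) , _) _ d₁ d₂ diam₁ diam₂
  with V₁→V₂ x x∈V₁
... | y , y∈V₂ , x-y =
  colouring , Bridge.rainbow G x∈V₁ y∈V₂ x-y dist₁ dist₂ dist₁-Dist dist₂-Dist
                (cover⇒dominating G cover V₂→V₁)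
                (cover⇒dominating G (trans (∪-comm V₂ V₁) cover) V₁→V₂)
                colouring colouring-separates
  where
  open DistanceTo G V₁ diam₁ x∈V₁ renaming (dist to dist₁; dist-Dist to dist₁-Dist; dist≤diam to dist₁≤d₁)
  open DistanceTo G V₂ diam₂ y∈V₂ renaming (dist to dist₂; dist-Dist to dist₂-Dist; dist≤diam to dist₂≤d₂)
  open Palette V₁ V₂ c-bound dist₁ dist₂ dist₁≤d₁ dist₂≤d₂ using (colouring; colouring-separates)
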